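{- Let $T=(T^{*},T^{\triangle})$ be a latin bitrade, let $a=(a_1,a_2,a_3)\in T^{*}$, and let $\mathbf{g}_T[a]=(h_1,h_2,h_3)$. Then $\mathbf{g}_T[a]$ is a homotopy of $T(*)$ into $\mathbf{H}(T)$ (in particular all values $h_i(b_i)$ lie in $\mathbf{H}(T)$); $\mathbf{g}_T[a]$ embeds $T(*)$ into $\mathbf{H}(T)$ if and only if $\mathbf{g}_T$ embeds $T(*)$ into $\mathbf{G}(T)$; and $\mathbf{H}(T)$ is generated by the set $\{h_1(b_1),h_2(b_2): (b_1,b_2,b_3)\in T^{*}\}$.
   Context: A latin bitrade is a pair $T=(T^{*},T^{\triangle})$ of finite sets of triples satisfying: (R1) $T^{*}\cap T^{\triangle}=\emptyset$; (R2) for every $p\in T^{*}$ and all $r\neq s$ in $\{1,2,3\}$ there is exactly one $q\in T^{\triangle}$ with $p_r=q_r$, $p_s=q_s$; (R3) for every $q\in T^{\triangle}$ and all $r\neq s$ there is exactly one $p\in T^{*}$ with $q_r=p_r$, $q_s=p_s$. First, second, third coordinates (rows, columns, symbols) use pairwise disjoint label sets. $T(*)$ is the partial operation with $u_1*u_2=u_3$ iff $(u_1,u_2,u_3)\in T^{*}$. A homotopy of $T(*)$ into an abelian group $G(+)$ is a triple $(\sigma_1,\sigma_2,\sigma_3)$, $\sigma_i$ defined on the set of $i$-th coordinates of elements of $T^{*}$, with $\sigma_1(u_1)+\sigma_2(u_2)=\sigma_3(u_3)$ for all $(u_1,u_2,u_3)\in T^{*}$; it is an embedding if all $\sigma_i$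 are injective. Let $F(T)$ be the free abelian group generated by all labels, $N(T)$ the subgroup generated by all $a_1+a_2-a_3$ with $(a_1,a_2,a_3)\in T^{*}$, $\mathbf{G}(T)=F(T)/N(T)$, and $\mathbf{g}_T=(g_1,g_2,g_3)$ with $g_i(x)=x+N(T)$. $\mathbf{H}(T)$ is the subgroup of $\mathbf{G}(T)$ generated by all $g_i(b_i)-g_i(d_i)$ with $(b_1,b_2,b_3),(d_1,d_2,d_3)\in T^{*}$ and $i\in\{1,2,3\}$. For $a\in T^{*}$, $\mathbf{g}_T[a]=(h_1,h_2,h_3)$ where $h_i(b_i)=g_i(b_i)-g_i(a_i)$ for every $(b_1,b_2,b_3)\in T^{*}$. -}

module Defs where

open import Data.Nat using (ℕ)
open import Data.Fin using (Fin; zero; suc)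
import Data.Fin as Fin
open import Data.Integer using (ℤ; _+_; _-_; _*_; 0ℤ; 1ℤ)
open import Data.Product using (_×_; _,_; proj₁; proj₂; ∃; ∃-syntax; ∃!)
open import Data.Sum using (_⊎_; inj₁; inj₂)
open import Data.Sum.Properties using (≡-dec)
open import Data.List using (List; []; _∷_; concatMap)
open import Data.List.Membership.Propositional using (_∈_; _∉_)
open import Relation.Binary.PropositionalEquality using (_≡_)
open import Relation.Nullary using (yes; no; ¬_)
open import Function.Bundles using (_⇔_)

-- Triples and labels.
-- Row labels are Fin r, column labels Fin c, symbol labels Fin s; the
-- three label sets are made disjoint by taking their disjoint union.

Triple : ℕ → ℕ → ℕ → Set
Triple r c s = Fin r × Fin c × Fin s

π₁ : ∀ {r c s} → Triple r c s → Fin r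
π₁ (x , _ , _) = x

π₂ : ∀ {r c s} → Triple r c s → Fin c
π₂ (_ , y , _) = y

π₃ : ∀ {r c s} → Triple r c s → Fin s
π₃ (_ , _ , z) = z

-- Agree k p q : p and q agree on the two coordinates different from k
-- (the pairs {r,s} with r ≠ s in {1,2,3} are exactly the complements of
-- a single coordinate k).
Agree : ∀ {r c s} → Fin 3 → Triple r c s → Triple r c s → Set
Agree zero          p q = π₂ p ≡ π₂ q × π₃ p ≡ π₃ q
Agree (suc zero)    p q = π₁ p ≡ π₁ q × π₃ p ≡ π₃ q
Agree (suc (suc _)) p q = π₁ p ≡ π₁ q × π₂ p ≡ π₂ q

-- The label sets are exactly the labels occurring in T* (fields
-- rows-used, cols-used, syms-used); by (R3) these are also all labels
-- occurring in T△.

record Bitrade (r c s : ℕ) : Set where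
  field
    T* : List (Triple r c s)
    T△ : List (Triple r c s)
    R1 : ∀ p → p ∈ T* → p ∉ T△
    R2 : ∀ p → p ∈ T* → ∀ (k : Fin 3) →
           ∃! _≡_ (λ q → q ∈ T△ × Agree k p q)
    R3 : ∀ q → q ∈ T△ → ∀ (k : Fin 3) →
           ∃! _≡_ (λ p → p ∈ T* × Agree k q p)
    rows-used : ∀ (x : Fin r) → ∃[ p ] (p ∈ T* × π₁ p ≡ x)
    cols-used : ∀ (y : Fin c) → ∃[ p ] (p ∈ T* × π₂ p ≡ y)
    syms-used : ∀ (z : Fin s) → ∃[ p ] (p ∈ T* × π₃ p ≡ z)

open Bitrade public

-- The free abelian group F(T) on all labels: functions Label → ℤ
-- (the label set is finite, so this is exactly ℤ^(Label)).

Label : ℕ → ℕ → ℕ → Set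
Label r c s = Fin r ⊎ Fin c ⊎ Fin s

Free : ℕ → ℕ → ℕ → Set
Free r c s = Label r c s → ℤ

module _ {r c s : ℕ} where

  _≟L_ : (u v : Label r c s) → _
  _≟L_ = ≡-dec Fin._≟_ (≡-dec Fin._≟_ Fin._≟_)

  e : Label r c s → Free r c s
  e u v with u ≟L v
  ... | yes _ = 1ℤ
  ... | no  _ = 0ℤ

  _⊕_ : Free r c s → Free r c s → Free r c s
  (x ⊕ y) l = x l + y l

  _⊖_ : Free r c s → Free r c s → Free r c s
  (x ⊖ y) l = x l - y l

  zeroF : Free r c s
  zeroF _ = 0ℤ

  -- integer linear combination  Σ_j cs_j · gs_j  (missing coefficients = 0)
  combo : List (Free r c s) → List ℤ → Free r c s
  combo (g ∷ gs) (k ∷ ks) l = k * g l + combo gs ks l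
  combo _        _        l = 0ℤ

  InSpan : List (Free r c s) → Free r c s → Set
  InSpan gs x = ∃[ ks ] (∀ l → x l ≡ combo gs ks l)

-- N(T), G(T) = F(T)/N(T) (as F(T) with the coset equality ≈G), g_T.

module _ {r c s : ℕ} (T : Bitrade r c s) where

  rel : Triple r c s → Free r c s
  rel p = (e (inj₁ (π₁ p)) ⊕ e (inj₂ (inj₁ (π₂ p)))) ⊖ e (inj₂ (inj₂ (π₃ p)))

  relsN : List (Free r c s)
  relsN = Data.List.map rel (T* T)

  InN : Free r c s → Set
  InN = InSpan relsN

  _≈G_ : Free r c s → Free r c s → Set
  x ≈G y = InN (x ⊖ y)

  g₁ : Fin r → Free r c s
  g₁ x = e (inj₁ x)

  g₂ : Fin c → Free r c s
  g₂ y = e (inj₂ (inj₁ y))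

  g₃ : Fin s → Free r c s
  g₃ z = e (inj₂ (inj₂ z))

  InGen : List (Free r c s) → Free r c s → Set
  InGen gs x = ∃[ ks ] (x ≈G combo gs ks)

  diffsH : List (Free r c s)
  diffsH = concatMap (λ b → concatMap (λ d →
             (g₁ (π₁ b) ⊖ g₁ (π₁ d)) ∷ (g₂ (π₂ b) ⊖ g₂ (π₂ d)) ∷
             (g₃ (π₃ b) ⊖ g₃ (π₃ d)) ∷ []) (T* T)) (T* T)

  InH : Free r c s → Set
  InH = InGen diffsH

  h₁ : Triple r c s → Fin r → Free r c s
  h₁ a x = g₁ x ⊖ g₁ (π₁ a)

  h₂ : Triple r c s → Fin c → Free r c s
  h₂ a y = g₂ y ⊖ g₂ (π₂ a)

  h₃ : Triple r c s → Fin s → Free r c s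
  h₃ a z = g₃ z ⊖ g₃ (π₃ a)

  gensS : Triple r c s → List (Free r c s)
  gensS a = concatMap (λ b → h₁ a (π₁ b) ∷ h₂ a (π₂ b) ∷ []) (T* T)

  -- (σ₁,σ₂,σ₃) is a homotopy of T(*) into the subgroup P of G(T)
  -- (P = λ _ → ⊤ gives G(T) itself); equality in a subgroup is
  -- equality in G(T).
  IsHomotopyInto : (Free r c s → Set) →
    (Fin r → Free r c s) → (Fin c → Free r c s) → (Fin s → Free r c s) → Set
  IsHomotopyInto P σ₁ σ₂ σ₃ =
    (∀ x → P (σ₁ x)) × (∀ y → P (σ₂ y)) × (∀ z → P (σ₃ z)) ×
    (∀ p → p ∈ T* T → (σ₁ (π₁ p) ⊕ σ₂ (π₂ p)) ≈G σ₃ (π₃ p))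

  IsEmbeddingInto : (Free r c s → Set) →
    (Fin r → Free r c s) → (Fin c → Free r c s) → (Fin s → Free r c s) → Set
  IsEmbeddingInto P σ₁ σ₂ σ₃ =
    IsHomotopyInto P σ₁ σ₂ σ₃ ×
    (∀ x x′ → σ₁ x ≈G σ₁ x′ → x ≡ x′) ×
    (∀ y y′ → σ₂ y ≈G σ₂ y′ → y ≡ y′) ×
    (∀ z z′ → σ₃ z ≈G σ₃ z′ → z ≡ z′)

-- Each label occurs in a triple b of
-- T*, so h_i of it is a generator g_i(b_i) - g_i(a_i) of H(T); the homotopy
-- defect of g_T[a] at p is rel(p) - rel(a) ∈ N(T); and translating every
-- g_i by the constant g_i(a_i) changes neither differences nor injectivity.
-- For generation, row and column differences of H(T) are differences of
-- h₁- and h₂-values, while rel(d) - rel(b) ∈ N(T) expresses a symbol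
-- difference g₃(b₃) - g₃(d₃) through the row and column values of b and d.
module Submission where

open import Defs
open import Data.Nat using (ℕ)
open import Data.Integer using (ℤ; _+_; _-_; _*_; 0ℤ; 1ℤ; -1ℤ)
open import Data.Integer.Properties using (i≡j⇒i-j≡0; +-identityˡ; +-identityʳ; *-zeroʳ)
open import Data.Integer.Tactic.RingSolver using (solve-∀)
open import Data.List using (List; []; _∷_; map; concatMap)
open import Data.List.Membership.Propositional using (_∈_; find; lose)
open import Data.List.Membership.Propositional.Properties
  using (∈-map⁺; ∈-concatMap⁺; ∈-concatMap⁻)
open import Data.List.Relation.Unary.Any using (here; there)
open import Data.Product using (_×_; _,_; ∃-syntax)
open import Data.Product.Function.NonDependent.Propositional using (_×-⇔_)
open import Data.Unit using (⊤; tt)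
open import Function using (_∘_; const)
open import Function.Bundles using (_⇔_; mk⇔)
open import Relation.Binary.PropositionalEquality using (_≡_; refl; sym; trans; cong; cong₂)

∈-concatMap-intro : ∀ {A B : Set} (f : A → List B) {xs : List A} {x : A} {y : B} →
  x ∈ xs → y ∈ f x → y ∈ concatMap f xs
∈-concatMap-intro f x∈xs y∈fx = ∈-concatMap⁺ f (lose x∈xs y∈fx)

∈-concatMap-elim : ∀ {A B : Set} (f : A → List B) {xs : List A} {y : B} →
  y ∈ concatMap f xs → ∃[ x ] (x ∈ xs × y ∈ f x)
∈-concatMap-elim f = find ∘ ∈-concatMap⁻ f

addCoeffs : List ℤ → List ℤ → List ℤ
addCoeffs []       ms       = ms
addCoeffs ks       []       = ks
addCoeffs (k ∷ ks) (m ∷ ms) = k + m ∷ addCoeffs ks ms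

module _ {r c s : ℕ} where

  infix 4 _≐_
  _≐_ : Free r c s → Free r c s → Set
  x ≐ y = ∀ l → x l ≡ y l

  _·_ : ℤ → Free r c s → Free r c s
  (k · x) l = k * x l

  ⊖-cancelʳ : ∀ u v w → (u ⊖ w) ⊖ (v ⊖ w) ≐ u ⊖ v
  ⊖-cancelʳ u v w l = identity (u l) (v l) (w l)
    where
    identity : ∀ x y z → (x - z) - (y - z) ≡ x - y
    identity = solve-∀

  record IsSubgroup (P : Free r c s → Set) : Set where
    field
      resp     : ∀ {x y} → x ≐ y → P x → P y
      0∈       : P zeroF
      ⊕-closed : ∀ {x y} → P x → P y → P (x ⊕ y)
      ·-closed : ∀ k {x} → P x → P (k · x)

    ⊖-closed : ∀ {x y} → P x → P y → P (x ⊖ y)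
    ⊖-closed {x} {y} px py = resp (λ l → identity (x l) (y l)) (⊕-closed px (·-closed -1ℤ py))
      where
      identity : ∀ i j → i + -1ℤ * j ≡ i - j
      identity = solve-∀

    combo-closed : ∀ {gs} → (∀ {g} → g ∈ gs → P g) → ∀ ks → P (combo gs ks)
    combo-closed {[]}    _     _        = 0∈
    combo-closed {_ ∷ _} _     []       = 0∈
    combo-closed {_ ∷ _} gs⊆P (k ∷ ks) =
      ⊕-closed (·-closed k (gs⊆P (here refl))) (combo-closed (gs⊆P ∘ there) ks)

  combo-[] : ∀ gs → combo gs [] ≐ zeroF
  combo-[] []      _ = refl
  combo-[] (_ ∷ _) _ = refl

  combo-addCoeffs : ∀ gs ks ms → combo gs (addCoeffs ks ms) ≐ combo gs ks ⊕ combo gs ms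
  combo-addCoeffs []       []       _        _ = refl
  combo-addCoeffs []       (_ ∷ _)  _        _ = refl
  combo-addCoeffs (g ∷ gs) []       ms       l = sym (+-identityˡ (combo (g ∷ gs) ms l))
  combo-addCoeffs (g ∷ gs) (k ∷ ks) []       l = sym (+-identityʳ (k * g l + combo gs ks l))
  combo-addCoeffs (g ∷ gs) (k ∷ ks) (m ∷ ms) l =
    trans (cong ((k + m) * g l +_) (combo-addCoeffs gs ks ms l))
          (identity k m (g l) (combo gs ks l) (combo gs ms l))
    where
    identity : ∀ k m x a b → (k + m) * x + (a + b) ≡ (k * x + a) + (m * x + b)
    identity = solve-∀

  combo-scale : ∀ gs k ks → combo gs (map (k *_) ks) ≐ k · combo gs ks
  combo-scale []       k _        _ = sym (*-zeroʳ k)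
  combo-scale (_ ∷ _)  k []       _ = sym (*-zeroʳ k)
  combo-scale (g ∷ gs) k (m ∷ ms) l =
    trans (cong (k * m * g l +_) (combo-scale gs k ms l)) (identity k m (g l) (combo gs ms l))
    where
    identity : ∀ k m x a → k * m * x + k * a ≡ k * (m * x + a)
    identity = solve-∀

  InSpan-isSubgroup : ∀ gs → IsSubgroup (InSpan gs)
  InSpan-isSubgroup gs = record
    { resp     = λ { x≐y (ks , x≐) → ks , λ l → trans (sym (x≐y l)) (x≐ l) }
    ; 0∈       = [] , λ l → sym (combo-[] gs l)
    ; ⊕-closed = λ { (ks , x≐) (ms , y≐) → addCoeffs ks ms , λ l →
                     trans (cong₂ _+_ (x≐ l) (y≐ l)) (sym (combo-addCoeffs gs ks ms l)) }
    ; ·-closed = λ { k (ks , x≐) → map (k *_) ks , λ l →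
                     trans (cong (k *_) (x≐ l)) (sym (combo-scale gs k ks l)) }
    }

  InSpan-⊇ : ∀ {gs g} → g ∈ gs → InSpan gs g
  InSpan-⊇ {h ∷ hs} (here refl) = 1ℤ ∷ [] , λ l →
    trans (identity (h l)) (cong (1ℤ * h l +_) (sym (combo-[] hs l)))
    where
    identity : ∀ x → x ≡ 1ℤ * x + 0ℤ
    identity = solve-∀
  InSpan-⊇ {h ∷ hs} (there g∈) with InSpan-⊇ g∈
  ... | ks , g≐ = 0ℤ ∷ ks , λ l → trans (g≐ l) (identity (h l) (combo hs ks l))
    where
    identity : ∀ x a → a ≡ 0ℤ * x + a
    identity = solve-∀

module _ {r c s : ℕ} (T : Bitrade r c s) where

  private
    module N = IsSubgroup (InSpan-isSubgroup (relsN T))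

  rel∈N : ∀ {p} → p ∈ T* T → InN T (rel T p)
  rel∈N p∈ = InSpan-⊇ (∈-map⁺ (rel T) p∈)

  ≐⇒≈G : ∀ {x y} → x ≐ y → _≈G_ T x y
  ≐⇒≈G x≐y = N.resp (λ l → sym (i≡j⇒i-j≡0 (x≐y l))) N.0∈

  InSpan⇒InGen : ∀ {gs x} → InSpan gs x → InGen T gs x
  InSpan⇒InGen (ks , x≐) = ks , ≐⇒≈G x≐

  InGen-resp-≈G : ∀ {gs x y} → _≈G_ T x y → InGen T gs y → InGen T gs x
  InGen-resp-≈G {gs} {x} {y} x≈y (ks , y≈) =
    ks , N.resp {y = x ⊖ combo gs ks} (λ l → identity (x l) (y l) (combo gs ks l))
                (N.⊕-closed x≈y y≈)
    where
    identity : ∀ x y z → (x - y) + (y - z) ≡ x - z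
    identity = solve-∀

  InGen-isSubgroup : ∀ gs → IsSubgroup (InGen T gs)
  InGen-isSubgroup gs = record
    { resp     = λ {x} {y} x≐y → InGen-resp-≈G {gs} {y} {x} (≐⇒≈G {y} {x} (sym ∘ x≐y))
    ; 0∈       = InSpan⇒InGen {gs} (IsSubgroup.0∈ (InSpan-isSubgroup gs))
    ; ⊕-closed = λ { {x} {y} (ks , x≈) (ms , y≈) → addCoeffs ks ms ,
                     N.resp {y = (x ⊕ y) ⊖ combo gs (addCoeffs ks ms)}
                       (λ l → trans (⊕-identity (x l) (y l) (combo gs ks l) (combo gs ms l))
                                    (cong (x l + y l -_) (sym (combo-addCoeffs gs ks ms l))))
                       (N.⊕-closed x≈ y≈) }
    ; ·-closed = λ { k {x} (ks , x≈) → map (k *_) ks ,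
                     N.resp {y = (k · x) ⊖ combo gs (map (k *_) ks)}
                       (λ l → trans (·-identity k (x l) (combo gs ks l))
                                    (cong (k * x l -_) (sym (combo-scale gs k ks l))))
                       (N.·-closed k x≈) }
    }
    where
    ⊕-identity : ∀ x y a b → (x - a) + (y - b) ≡ (x + y) - (a + b)
    ⊕-identity = solve-∀
    ·-identity : ∀ k x a → k * (x - a) ≡ k * x - k * a
    ·-identity = solve-∀

  InGen-⊇ : ∀ {gs g} → g ∈ gs → InGen T gs g
  InGen-⊇ {gs} g∈ = InSpan⇒InGen {gs} (InSpan-⊇ g∈)

  InGen-⊆ : ∀ {gs hs} → (∀ {g} → g ∈ gs → InGen T hs g) → ∀ {x} → InGen T gs x → InGen T hs x
  InGen-⊆ {gs} {hs} gs⊆ {x} (ks , x≈) =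
    InGen-resp-≈G {hs} {x} {combo gs ks} x≈
      (IsSubgroup.combo-closed (InGen-isSubgroup hs) gs⊆ ks)

  g-isHomotopy : IsHomotopyInto T (λ _ → ⊤) (g₁ T) (g₂ T) (g₃ T)
  g-isHomotopy = const tt , const tt , const tt , λ _ → rel∈N

  translate-injective⇔ : ∀ {A : Set} (σ : A → Free r c s) w →
    (∀ x x′ → _≈G_ T (σ x ⊖ w) (σ x′ ⊖ w) → x ≡ x′) ⇔
    (∀ x x′ → _≈G_ T (σ x) (σ x′) → x ≡ x′)
  translate-injective⇔ σ w = mk⇔
    (λ inj x x′ → inj x x′ ∘ N.resp (sym ∘ ⊖-cancelʳ (σ x) (σ x′) w))
    (λ inj x x′ → inj x x′ ∘ N.resp (⊖-cancelʳ (σ x) (σ x′) w))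

  labelDiffs : Triple r c s → Triple r c s → List (Free r c s)
  labelDiffs b d = (g₁ T (π₁ b) ⊖ g₁ T (π₁ d)) ∷ (g₂ T (π₂ b) ⊖ g₂ T (π₂ d))
                 ∷ (g₃ T (π₃ b) ⊖ g₃ T (π₃ d)) ∷ []

  labelDiffs⊆diffsH : ∀ {b d g} → b ∈ T* T → d ∈ T* T → g ∈ labelDiffs b d → g ∈ diffsH T
  labelDiffs⊆diffsH {b} b∈ d∈ g∈ =
    ∈-concatMap-intro (λ b → concatMap (labelDiffs b) (T* T)) b∈
      (∈-concatMap-intro (labelDiffs b) d∈ g∈)

  module _ {a : Triple r c s} (a∈ : a ∈ T* T) where

    h₁∈H : ∀ x → InH T (h₁ T a x)
    h₁∈H x with rows-used T x
    ... | b , b∈ , refl = InGen-⊇ (labelDiffs⊆diffsH b∈ a∈ (here refl))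

    h₂∈H : ∀ y → InH T (h₂ T a y)
    h₂∈H y with cols-used T y
    ... | b , b∈ , refl = InGen-⊇ (labelDiffs⊆diffsH b∈ a∈ (there (here refl)))

    h₃∈H : ∀ z → InH T (h₃ T a z)
    h₃∈H z with syms-used T z
    ... | b , b∈ , refl = InGen-⊇ (labelDiffs⊆diffsH b∈ a∈ (there (there (here refl))))

    h-defect≐rel-defect : ∀ p →
      (h₁ T a (π₁ p) ⊕ h₂ T a (π₂ p)) ⊖ h₃ T a (π₃ p) ≐ rel T p ⊖ rel T a
    h-defect≐rel-defect p l = identity
      (g₁ T (π₁ p) l) (g₂ T (π₂ p) l) (g₃ T (π₃ p) l)
      (g₁ T (π₁ a) l) (g₂ T (π₂ a) l) (g₃ T (π₃ a) l)
      where
      identity : ∀ p₁ p₂ p₃ a₁ a₂ a₃ →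
        ((p₁ - a₁) + (p₂ - a₂)) - (p₃ - a₃) ≡ ((p₁ + p₂) - p₃) - ((a₁ + a₂) - a₃)
      identity = solve-∀

    h-isHomotopy : IsHomotopyInto T (InH T) (h₁ T a) (h₂ T a) (h₃ T a)
    h-isHomotopy = h₁∈H , h₂∈H , h₃∈H , λ p p∈ →
      N.resp (sym ∘ h-defect≐rel-defect p) (N.⊖-closed (rel∈N p∈) (rel∈N a∈))

    h-embedding⇔g-embedding :
      IsEmbeddingInto T (InH T) (h₁ T a) (h₂ T a) (h₃ T a) ⇔
      IsEmbeddingInto T (λ _ → ⊤) (g₁ T) (g₂ T) (g₃ T)
    h-embedding⇔g-embedding =
      mk⇔ (const g-isHomotopy) (const h-isHomotopy)
        ×-⇔ translate-injective⇔ (g₁ T) (g₁ T (π₁ a))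
        ×-⇔ translate-injective⇔ (g₂ T) (g₂ T (π₂ a))
        ×-⇔ translate-injective⇔ (g₃ T) (g₃ T (π₃ a))

    private
      module ⟨S⟩ = IsSubgroup (InGen-isSubgroup (gensS T a))

      rowColValues : Triple r c s → List (Free r c s)
      rowColValues b = h₁ T a (π₁ b) ∷ h₂ T a (π₂ b) ∷ []

    gensS⊆H : ∀ {g} → g ∈ gensS T a → InH T g
    gensS⊆H g∈ with ∈-concatMap-elim rowColValues {T* T} g∈
    ... | b , _ , here refl         = h₁∈H (π₁ b)
    ... | b , _ , there (here refl) = h₂∈H (π₂ b)

    h₁∈⟨S⟩ : ∀ {b} → b ∈ T* T → InGen T (gensS T a) (h₁ T a (π₁ b))
    h₁∈⟨S⟩ {b} b∈ = InGen-⊇ {gensS T a} (∈-concatMap-intro rowColValues b∈ (here refl))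

    h₂∈⟨S⟩ : ∀ {b} → b ∈ T* T → InGen T (gensS T a) (h₂ T a (π₂ b))
    h₂∈⟨S⟩ {b} b∈ = InGen-⊇ {gensS T a} (∈-concatMap-intro rowColValues b∈ (there (here refl)))

    rowCol : Triple r c s → Free r c s
    rowCol b = h₁ T a (π₁ b) ⊕ h₂ T a (π₂ b)

    rowCol∈⟨S⟩ : ∀ {b} → b ∈ T* T → InGen T (gensS T a) (rowCol b)
    rowCol∈⟨S⟩ {b} b∈ =
      ⟨S⟩.⊕-closed {h₁ T a (π₁ b)} {h₂ T a (π₂ b)} (h₁∈⟨S⟩ b∈) (h₂∈⟨S⟩ b∈)

    symbolDiff≈rowColDiff : ∀ {b d} → b ∈ T* T → d ∈ T* T →
      _≈G_ T (g₃ T (π₃ b) ⊖ g₃ T (π₃ d)) (rowCol b ⊖ rowCol d)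
    symbolDiff≈rowColDiff {b} {d} b∈ d∈ =
      N.resp (λ l → identity (g₁ T (π₁ b) l) (g₂ T (π₂ b) l) (g₃ T (π₃ b) l)
                             (g₁ T (π₁ d) l) (g₂ T (π₂ d) l) (g₃ T (π₃ d) l)
                             (g₁ T (π₁ a) l) (g₂ T (π₂ a) l))
             (N.⊖-closed (rel∈N d∈) (rel∈N b∈))
      where
      identity : ∀ b₁ b₂ b₃ d₁ d₂ d₃ a₁ a₂ →
        ((d₁ + d₂) - d₃) - ((b₁ + b₂) - b₃) ≡
        (b₃ - d₃) - (((b₁ - a₁) + (b₂ - a₂)) - ((d₁ - a₁) + (d₂ - a₂)))
      identity = solve-∀

    diffsH⊆⟨S⟩ : ∀ {g} → g ∈ diffsH T → InGen T (gensS T a) g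
    diffsH⊆⟨S⟩ g∈ with ∈-concatMap-elim (λ b → concatMap (labelDiffs b) (T* T)) {T* T} g∈
    ... | b , b∈ , g∈′ with ∈-concatMap-elim (labelDiffs b) {T* T} g∈′
    ... | d , d∈ , here refl =
      ⟨S⟩.resp {h₁ T a (π₁ b) ⊖ h₁ T a (π₁ d)}
        (⊖-cancelʳ (g₁ T (π₁ b)) (g₁ T (π₁ d)) (g₁ T (π₁ a)))
        (⟨S⟩.⊖-closed {h₁ T a (π₁ b)} {h₁ T a (π₁ d)} (h₁∈⟨S⟩ b∈) (h₁∈⟨S⟩ d∈))
    ... | d , d∈ , there (here refl) =
      ⟨S⟩.resp {h₂ T a (π₂ b) ⊖ h₂ T a (π₂ d)}
        (⊖-cancelʳ (g₂ T (π₂ b)) (g₂ T (π₂ d)) (g₂ T (π₂ a)))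
        (⟨S⟩.⊖-closed {h₂ T a (π₂ b)} {h₂ T a (π₂ d)} (h₂∈⟨S⟩ b∈) (h₂∈⟨S⟩ d∈))
    ... | d , d∈ , there (there (here refl)) =
      InGen-resp-≈G {gensS T a} {g₃ T (π₃ b) ⊖ g₃ T (π₃ d)} (symbolDiff≈rowColDiff b∈ d∈)
        (⟨S⟩.⊖-closed {rowCol b} {rowCol d} (rowCol∈⟨S⟩ b∈) (rowCol∈⟨S⟩ d∈))

    H⇔⟨S⟩ : ∀ x → InH T x ⇔ InGen T (gensS T a) x
    H⇔⟨S⟩ x = mk⇔ (InGen-⊆ {diffsH T} {gensS T a} diffsH⊆⟨S⟩ {x})
                  (InGen-⊆ {gensS T a} {diffsH T} gensS⊆H {x})

lemma5p6 : ∀ {r c s} (T : Bitrade r c s) (a : Triple r c s) → a ∈ T* T →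
    IsHomotopyInto T (InH T) (h₁ T a) (h₂ T a) (h₃ T a)
    × (IsEmbeddingInto T (InH T) (h₁ T a) (h₂ T a) (h₃ T a)
        ⇔ IsEmbeddingInto T (λ _ → ⊤) (g₁ T) (g₂ T) (g₃ T))
    × (∀ x → InH T x ⇔ InGen T (gensS T a) x)
lemma5p6 T a a∈ = h-isHomotopy T a∈ , h-embedding⇔g-embedding T a∈ , H⇔⟨S⟩ T a∈
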